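{- Let $\Delta\ge 1$ and let $n$ be an even integer with $n>\Delta^{20}$. Let $(\vec{s},\vec{s'})$ and $(\vec{p},\vec{p'})$ be two configuration vector pairs for $n$ and $\Delta$ (as defined in the context) such that $\max_i |s_i-p_i|\le n^{3/4}$ and $\max_i |s_i'-p_i'|\le n^{3/4}$. Then $P(\vec{s},\vec{s'}) \le 2^{o(n)} P(\vec{p},\vec{p'})$, where the $o(n)$ term is a function of $n$ alone (independent of the vectors and of $\Delta$, given $n>\Delta^{20}$) with $o(n)/n\to 0$.
   Context: A configuration vector pair for $n,\Delta$ is a pair of vectors $\vec{s}=(s_0,\dots,s_\Delta)$, $\vec{s'}=(s_0',\dots,s_\Delta')$ of nonnegative integers with $\sum_i s_i+\sum_i s_i'=n$ and $\sum_i i s_i=\sum_i i s_i'=:c$. (Interpretation: $S$ is a vertex set with $|S|=\sum_i s_i$, $s_i$ is the number of vertices of $S$ with exactly $i$ neighbours outside $S$, $s_i'$ the number of vertices outside $S$ with exactly $i$ neighbours in $S$, and $c$ is the cut size.) For an integer $m$, $m!!$ denotes the product of all odd positive integers at most $m$ (so for even $m$, $m!!=(m-1)(m-3)\cdots 1$). Writing $|S|=\sum_i s_i$ and $|V\setminus S|=\sum_i s_i'=n-|S|$, define $$P(\vec{s},\vec{s'})=\frac{|S|!}{s_0!\cdots s_\Delta!}\prod_{i=0}^{\Delta}\binom{\Delta}{i}^{s_i}\cdot\frac{|V\setminus S|!}{s_0'!\cdots s_\Delta'!}\prod_{i=0}^{\Delta}\binom{\Delta}{i}^{s_i'}\cdot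 c!\,\frac{(\Delta|S|-c)!!\,(\Delta|V\setminus S|-c)!!}{(\Delta n)!!}.$$ -}

module Defs where

open import Data.Nat using (ℕ; zero; suc; _+_; _*_; _∸_; _^_; _≤_; _<_; NonZero)
open import Data.Nat.Properties using (m*n≢0; _!≢0)
open import Data.Nat.Combinatorics using (_C_)
open import Data.Nat.Base using (_!)
open import Data.Fin using (Fin; toℕ) renaming (zero to fzero; suc to fsuc)
open import Data.Bool using (Bool; true; false; not; if_then_else_)
open import Data.Integer using (+_)
open import Data.Rational using (ℚ; _/_) renaming (_*_ to _*ℚ_)
open import Data.Product using (_×_)
open import Relation.Binary.PropositionalEquality using (_≡_)

sumF : ∀ {k} → (Fin k → ℕ) → ℕ
sumF {zero}  f = 0
sumF {suc k} f = f fzero + sumF (λ i → f (fsuc i))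

prodF : ∀ {k} → (Fin k → ℕ) → ℕ
prodF {zero}  f = 1
prodF {suc k} f = f fzero * prodF (λ i → f (fsuc i))

prodFact-nz : ∀ {k} (f : Fin k → ℕ) → NonZero (prodF (λ i → f i !))
prodFact-nz {zero}  f = _
prodFact-nz {suc k} f =
  m*n≢0 (f fzero !) (prodF (λ i → f (fsuc i) !))
    {{f fzero !≢0}} {{prodFact-nz (λ i → f (fsuc i))}}

isOdd : ℕ → Bool
isOdd zero    = false
isOdd (suc m) = not (isOdd m)

-- double factorial: m!! = product of all odd positive integers ≤ m
_!! : ℕ → ℕ
zero !!    = 1
(suc m) !! = if isOdd (suc m) then suc m * (m !!) else m !!

dfact-nz : ∀ m → NonZero (m !!)
dfact-nz zero = _
dfact-nz (suc m) with isOdd (suc m)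
... | true  = m*n≢0 (suc m) (m !!) {{_}} {{dfact-nz m}}
... | false = dfact-nz m

CVec : ℕ → Set
CVec Δ = Fin (suc Δ) → ℕ

cut : ∀ {Δ} → CVec Δ → ℕ
cut s = sumF (λ i → toℕ i * s i)

IsConfigPair : (n Δ : ℕ) → CVec Δ → CVec Δ → Set
IsConfigPair n Δ s s' = (sumF s + sumF s' ≡ n) × (cut s ≡ cut s')

multinom : ∀ {Δ} → CVec Δ → ℚ
multinom s = (+ (sumF s !) / prodF (λ i → s i !)) {{prodFact-nz s}}

binomProd : (Δ : ℕ) → CVec Δ → ℚ
binomProd Δ s = + prodF (λ i → (Δ C toℕ i) ^ s i) / 1

-- P(s, s')  (here n = |S| + |V∖S|)
P : (Δ : ℕ) → CVec Δ → CVec Δ → ℚ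
P Δ s s' =
  multinom s *ℚ binomProd Δ s *ℚ multinom s' *ℚ binomProd Δ s' *ℚ
  (+ (cut s ! * (Δ * sumF s ∸ cut s) !! * (Δ * sumF s' ∸ cut s) !!)
     / (Δ * (sumF s + sumF s')) !!) {{dfact-nz (Δ * (sumF s + sumF s'))}}

module Submission where

-- Write t = ⌈n^(1/20)⌉ and M = Δn.  From Δ^20 < n ≤ t^20 we get Δ < t, and
-- |s_i - p_i| ≤ n^(3/4) ≤ t^15 gives an ℓ¹ distance of at most (Δ+1)t^15 ≤ t^16
-- between s and p (likewise between s' and p').  Every factor of P is a
-- "factorial-like" function (a!, a!!, c^a with c ≤ M^Δ) evaluated at arguments
-- at most M, and moving such an argument by d changes the value by a factor of
-- at most M^d.  All arguments move by at most K = 2Δt^16, so P(s,s') is at most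
-- M^(9K) · P(p,p') ≤ 2^(378 t^18) · P(p,p'), and 378·⌈n^(1/20)⌉^18 = o(n).

open import Defs
open import Data.Nat using (ℕ; _*_; _^_; _≤_; _<_; ∣_-_∣)
open import Data.Nat.Divisibility using (_∣_)
open import Data.Integer using (+_)
open import Data.Rational using (_/_) renaming (_*_ to _*ℚ_; _≤_ to _≤ℚ_)
open import Data.Product using (Σ; _×_; ∃-syntax)

open import Data.Nat using (zero; suc; _+_; _∸_; NonZero; z≤n; s≤s; _!; _≤?_; _<?_; >-nonZero; s≤s⁻¹)
open import Data.Nat.Properties
open import Data.Nat.Combinatorics using (_C_; nCk+nC[k+1]≡[n+1]C[k+1])
open import Data.Nat.Solver using (module +-*-Solver)
open import Data.Fin using (Fin; toℕ) renaming (zero to fzero; suc to fsuc)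
open import Data.Fin.Properties using (toℕ≤pred[n])
open import Data.Bool using (true; false)
open import Data.Product using (_,_; proj₁; proj₂)
open import Data.Sum using (inj₁; inj₂)
open import Data.Empty using (⊥-elim)
open import Relation.Nullary using (yes; no)
open import Relation.Binary.PropositionalEquality
import Data.Integer as ℤ
open import Data.Integer.Properties using (pos-*)
open import Data.Rational using (ℚ; toℚᵘ)
open import Data.Rational.Properties
  using (toℚᵘ-fromℚᵘ; toℚᵘ-injective; toℚᵘ-homo-*; toℚᵘ-cancel-≤; /-cong)
open import Data.Rational.Unnormalised using (mkℚᵘ; *≤*) renaming (_≃_ to _≃ᵘ_)
open import Data.Rational.Unnormalised.Properties
  using (≃-trans; ≃-sym; ≃-reflexive; *-cong; ≤-respˡ-≃; ≤-respʳ-≃)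

open +-*-Solver using (solve; _:=_; _:+_; _:*_; con)

-- x is at most y up to the factor M ^ a.  A record, so that the indices can
-- be inferred from a proof.
record Dominated (M a x y : ℕ) : Set where
  constructor dominated
  field bound : x ≤ M ^ a * y

open Dominated

dominated-≡ : ∀ {M x y} → x ≡ y → Dominated M 0 x y
dominated-≡ {y = y} refl = dominated (≤-reflexive (sym (+-identityʳ y)))

dominated-* : ∀ {M a b x y X Y} →
              Dominated M a x y → Dominated M b X Y → Dominated M (a + b) (x * X) (y * Y)
dominated-* {M} {a} {b} {x} {y} {X} {Y} (dominated x≤) (dominated X≤) = dominated (begin
  x * X                     ≤⟨ *-mono-≤ x≤ X≤ ⟩
  (M ^ a * y) * (M ^ b * Y) ≡⟨ solve 4 (λ A B y Y → (A :* y) :* (B :* Y) := (A :* B) :* (y :* Y))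
                                  refl (M ^ a) (M ^ b) y Y ⟩
  (M ^ a * M ^ b) * (y * Y) ≡⟨ cong (_* (y * Y)) (^-distribˡ-+-* M a b) ⟨
  M ^ (a + b) * (y * Y)     ∎)
  where open ≤-Reasoning

dominated-power : ∀ {M a k x y} → Dominated (M ^ a) k x y → Dominated M (a * k) x y
dominated-power {M} {a} {k} {y = y} (dominated x≤) = dominated (subst (λ z → _ ≤ z * y) (^-*-assoc M a k) x≤)

dominated-weaken : ∀ {M a b x y} .{{_ : NonZero M}} → a ≤ b → Dominated M a x y → Dominated M b x y
dominated-weaken {M} {y = y} a≤b (dominated x≤) =
  dominated (≤-trans x≤ (*-monoˡ-≤ y (^-monoʳ-≤ M a≤b)))

sumF-mono : ∀ {k} (f g : Fin k → ℕ) → (∀ i → f i ≤ g i) → sumF f ≤ sumF g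
sumF-mono {zero}  f g f≤g = z≤n
sumF-mono {suc k} f g f≤g =
  +-mono-≤ (f≤g fzero) (sumF-mono (λ i → f (fsuc i)) (λ i → g (fsuc i)) (λ i → f≤g (fsuc i)))

sumF-*ˡ : ∀ {k} c (f : Fin k → ℕ) → sumF (λ i → c * f i) ≡ c * sumF f
sumF-*ˡ {zero}  c f = sym (*-zeroʳ c)
sumF-*ˡ {suc k} c f =
  trans (cong (_+_ (c * f fzero)) (sumF-*ˡ c (λ i → f (fsuc i)))) (sym (*-distribˡ-+ c (f fzero) _))

sumF-bounded : ∀ {k} (f : Fin k → ℕ) b → (∀ i → f i ≤ b) → sumF f ≤ k * b
sumF-bounded {zero}  f b f≤b = z≤n
sumF-bounded {suc k} f b f≤b = +-mono-≤ (f≤b fzero) (sumF-bounded (λ i → f (fsuc i)) b (λ i → f≤b (fsuc i)))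

term≤sumF : ∀ {k} (f : Fin k → ℕ) i → f i ≤ sumF f
term≤sumF f fzero    = m≤m+n _ _
term≤sumF f (fsuc i) = ≤-trans (term≤sumF (λ j → f (fsuc j)) i) (m≤n+m _ _)

sumF-∣-∣ : ∀ {k} (f g : Fin k → ℕ) → ∣ sumF f - sumF g ∣ ≤ sumF (λ i → ∣ f i - g i ∣)
sumF-∣-∣ {zero}  f g = z≤n
sumF-∣-∣ {suc k} f g = begin
  ∣ f fzero + F - (g fzero + G) ∣                  ≤⟨ ∣-∣-triangle (f fzero + F) (g fzero + F) (g fzero + G) ⟩
  ∣ f fzero + F - (g fzero + F) ∣ + ∣ g fzero + F - (g fzero + G) ∣
    ≡⟨ cong₂ _+_ (trans (cong₂ ∣_-_∣ (+-comm (f fzero) F) (+-comm (g fzero) F))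
                        (∣m+n-m+o∣≡∣n-o∣ F (f fzero) (g fzero)))
                 (∣m+n-m+o∣≡∣n-o∣ (g fzero) F G) ⟩
  ∣ f fzero - g fzero ∣ + ∣ F - G ∣                ≤⟨ +-monoʳ-≤ _ (sumF-∣-∣ (λ i → f (fsuc i)) (λ i → g (fsuc i))) ⟩
  sumF (λ i → ∣ f i - g i ∣)                       ∎
  where
  open ≤-Reasoning
  F G : ℕ
  F = sumF (λ i → f (fsuc i))
  G = sumF (λ i → g (fsuc i))

prodF-dominated : ∀ {k M} (f g e : Fin k → ℕ) →
                  (∀ i → Dominated M (e i) (f i) (g i)) → Dominated M (sumF e) (prodF f) (prodF g)
prodF-dominated {zero}  f g e f≼g = dominated-≡ refl
prodF-dominated {suc k} f g e f≼g =
  dominated-* (f≼g fzero) (prodF-dominated (λ i → f (fsuc i)) (λ i → g (fsuc i)) (λ i → e (fsuc i)) (λ i → f≼g (fsuc i)))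

record FactorialLike (g : ℕ → ℕ) : Set where
  field
    step : ∀ a → g (suc a) ≤ suc a * g a
    mono : ∀ a → g a ≤ g (suc a)

module _ {g : ℕ → ℕ} (g-fl : FactorialLike g) where
  open FactorialLike g-fl

  factorialLike-mono : ∀ {a b} → a ≤ b → g a ≤ g b
  factorialLike-mono {a} {b} a≤b = subst (λ z → g a ≤ g z) (m∸n+n≡m a≤b) (up (b ∸ a))
    where
    up : ∀ k → g a ≤ g (k + a)
    up zero    = ≤-refl
    up (suc k) = ≤-trans (up k) (mono (k + a))

  factorialLike-shift : ∀ {M} k b → k + b ≤ M → Dominated M k (g (k + b)) (g b)
  factorialLike-shift     zero    b _ = dominated-≡ refl
  factorialLike-shift {M} (suc k) b k+b<M = dominated (begin
    g (suc (k + b))         ≤⟨ step (k + b) ⟩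
    suc (k + b) * g (k + b) ≤⟨ *-mono-≤ k+b<M (bound (factorialLike-shift k b (<⇒≤ k+b<M))) ⟩
    M * (M ^ k * g b)       ≡⟨ *-assoc M (M ^ k) (g b) ⟨
    M ^ suc k * g b         ∎)
    where open ≤-Reasoning

  factorialLike-dominated : ∀ {M} a b → a ≤ M → Dominated M (a ∸ b) (g a) (g b)
  factorialLike-dominated a b a≤M with ≤-total b a
  ... | inj₁ b≤a = subst (λ z → Dominated _ (a ∸ b) (g z) (g b)) (m∸n+n≡m b≤a)
                     (factorialLike-shift (a ∸ b) b (subst (_≤ _) (sym (m∸n+n≡m b≤a)) a≤M))
  ... | inj₂ a≤b rewrite m≤n⇒m∸n≡0 a≤b =
    dominated (≤-trans (factorialLike-mono a≤b) (≤-reflexive (sym (+-identityʳ (g b)))))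

factorial-fl : FactorialLike _!
factorial-fl = record { step = λ a → ≤-refl ; mono = λ a → m≤n*m (a !) (suc a) }

doubleFactorial-fl : FactorialLike _!!
doubleFactorial-fl = record { step = step ; mono = mono }
  where
  step : ∀ a → suc a !! ≤ suc a * a !!
  step a with isOdd a
  ... | true  = m≤n*m (a !!) (suc a)
  ... | false = ≤-refl
  mono : ∀ a → a !! ≤ suc a !!
  mono a with isOdd a
  ... | true  = ≤-refl
  ... | false = m≤n*m (a !!) (suc a)

-- 1 ≤ binom(n,k) ≤ 2^n: the bases of the binomial powers in P lie in [1, M^Δ].
C-positive : ∀ n k → k ≤ n → 1 ≤ n C k
C-positive n       zero    _         = ≤-refl
C-positive (suc n) (suc k) (s≤s k≤n) =
  ≤-trans (C-positive n k k≤n) (≤-trans (m≤m+n (n C k) _) (≤-reflexive (nCk+nC[k+1]≡[n+1]C[k+1] n k)))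

C≤2^ : ∀ n k → n C k ≤ 2 ^ n
C≤2^ n       zero    = m^n>0 2 n
C≤2^ zero    (suc k) = z≤n
C≤2^ (suc n) (suc k) = begin
  suc n C suc k     ≡⟨ nCk+nC[k+1]≡[n+1]C[k+1] n k ⟨
  n C k + n C suc k ≤⟨ +-mono-≤ (C≤2^ n k) (C≤2^ n (suc k)) ⟩
  2 ^ n + 2 ^ n     ≡⟨ cong (_+_ (2 ^ n)) (+-identityʳ (2 ^ n)) ⟨
  2 ^ suc n         ∎
  where open ≤-Reasoning

power-dominated : ∀ {c B} a b → 1 ≤ c → c ≤ B → Dominated B (a ∸ b) (c ^ a) (c ^ b)
power-dominated {c} {B} a b 1≤c c≤B with ≤-total b a
... | inj₁ b≤a = dominated (begin
  c ^ a               ≡⟨ cong (c ^_) (m∸n+n≡m b≤a) ⟨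
  c ^ (a ∸ b + b)     ≡⟨ ^-distribˡ-+-* c (a ∸ b) b ⟩
  c ^ (a ∸ b) * c ^ b ≤⟨ *-monoˡ-≤ (c ^ b) (^-monoˡ-≤ (a ∸ b) c≤B) ⟩
  B ^ (a ∸ b) * c ^ b ∎)
  where open ≤-Reasoning
... | inj₂ a≤b rewrite m≤n⇒m∸n≡0 a≤b =
  dominated (≤-trans (^-monoʳ-≤ c {{>-nonZero 1≤c}} a≤b) (≤-reflexive (sym (+-identityʳ (c ^ b)))))

^-distribʳ-* : ∀ a b n → (a * b) ^ n ≡ a ^ n * b ^ n
^-distribʳ-* a b zero    = refl
^-distribʳ-* a b (suc n) = trans (cong ((a * b) *_) (^-distribʳ-* a b n))
  (solve 4 (λ a b x y → (a :* b) :* (x :* y) := (a :* x) :* (b :* y)) refl a b (a ^ n) (b ^ n))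

^-reflectˡ-< : ∀ e {a b} → a ^ e < b ^ e → a < b
^-reflectˡ-< e {a} {b} a^e<b^e with a <? b
... | yes a<b = a<b
... | no  a≮b = ⊥-elim (<⇒≱ a^e<b^e (^-monoˡ-≤ e (≮⇒≥ a≮b)))

^-reflectˡ-≤ : ∀ e .{{_ : NonZero e}} {a b} → a ^ e ≤ b ^ e → a ≤ b
^-reflectˡ-≤ e {a} {b} a^e≤b^e with a ≤? b
... | yes a≤b = a≤b
... | no  a≰b = ⊥-elim (<⇒≱ (^-monoˡ-< e (≰⇒> a≰b)) a^e≤b^e)

n≤2^n : ∀ n → n ≤ 2 ^ n
n≤2^n zero    = z≤n
n≤2^n (suc n) = begin
  suc n         ≤⟨ +-mono-≤ (m^n>0 2 n) (n≤2^n n) ⟩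
  2 ^ n + 2 ^ n ≡⟨ cong (_+_ (2 ^ n)) (+-identityʳ (2 ^ n)) ⟨
  2 ^ suc n     ∎
  where open ≤-Reasoning

-- r = ⌈n^(1/e)⌉: the least r with n ≤ r^e.
record IsCeilRoot (e n r : ℕ) : Set where
  field
    above : n ≤ r ^ e
    below : ∀ {u} → r ≡ suc u → u ^ e < n

open IsCeilRoot

-- Computed incrementally: passing from n to n+1 the root grows by at most one.
ceilRoot : ℕ → ℕ → ℕ
ceilRoot e zero    = 0
ceilRoot e (suc n) with suc n ≤? ceilRoot e n ^ e
... | yes _ = ceilRoot e n
... | no  _ = suc (ceilRoot e n)

ceilRoot-correct : ∀ e .{{_ : NonZero e}} n → IsCeilRoot e n (ceilRoot e n)
ceilRoot-correct e zero = record { above = z≤n ; below = λ () }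
ceilRoot-correct e (suc n) with suc n ≤? ceilRoot e n ^ e | ceilRoot-correct e n
... | yes n<r^e | r = record { above = n<r^e ; below = λ eq → m<n⇒m<1+n (below r eq) }
... | no  n≮r^e | r = record { above = n<[1+r]^e ; below = λ { refl → r^e≤n } }
  where
  r^e≤n : ceilRoot e n ^ e < suc n
  r^e≤n = ≰⇒> n≮r^e
  n≡r^e : n ≡ ceilRoot e n ^ e
  n≡r^e = ≤-antisym (above r) (s≤s⁻¹ r^e≤n)
  n<[1+r]^e : suc n ≤ suc (ceilRoot e n) ^ e
  n<[1+r]^e = subst (λ z → suc z ≤ suc (ceilRoot e n) ^ e) (sym n≡r^e) (^-monoˡ-< e (n<1+n _))

Sublinear : (ℕ → ℕ) → Set
Sublinear f = ∀ k → ∃[ N ] ∀ m → N ≤ m → k * f m ≤ m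

-- c · ⌈m^(1/(e+2))⌉^e = o(m).  With r = u + 1 the root, u^(e+2) < m; if u is
-- large, c(u+1)^e ≤ c 2^e u^e ≤ u^(e+2), and otherwise the left side is bounded.
ceilRoot-power-sublinear : ∀ c e → Sublinear (λ m → c * ceilRoot (2 + e) m ^ e)
ceilRoot-power-sublinear c e k = L ^ suc e , bounded
  where
  L : ℕ
  L = suc (k * c * 2 ^ e)

  kc≤L : k * c ≤ L
  kc≤L = ≤-trans (m≤m*n (k * c) (2 ^ e) {{m^n≢0 2 e}}) (n≤1+n _)

  bounded : ∀ m → L ^ suc e ≤ m → k * (c * ceilRoot (2 + e) m ^ e) ≤ m
  bounded m L^e≤m rewrite sym (*-assoc k c (ceilRoot (2 + e) m ^ e))
    with ceilRoot (2 + e) m | ceilRoot-correct (2 + e) m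
  ... | zero  | r = ⊥-elim (<-irrefl refl (≤-trans (m^n>0 L (suc e)) (≤-trans L^e≤m (above r))))
  ... | suc u | r with L ≤? u
  ...   | yes L≤u = ≤-trans large (<⇒≤ (below r refl))
    where
    1≤u : 1 ≤ u
    1≤u = ≤-trans (s≤s z≤n) L≤u
    large : k * c * suc u ^ e ≤ u ^ (2 + e)
    large = begin
      k * c * suc u ^ e       ≤⟨ *-monoʳ-≤ (k * c) (^-monoˡ-≤ e (+-monoˡ-≤ u 1≤u)) ⟩
      k * c * (u + u) ^ e     ≡⟨ cong (λ z → k * c * z ^ e) (cong (_+_ u) (+-identityʳ u)) ⟨
      k * c * (2 * u) ^ e     ≡⟨ cong ((k * c) *_) (^-distribʳ-* 2 u e) ⟩
      k * c * (2 ^ e * u ^ e) ≡⟨ *-assoc (k * c) (2 ^ e) (u ^ e) ⟨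
      k * c * 2 ^ e * u ^ e   ≤⟨ *-monoˡ-≤ (u ^ e) (≤-trans (n≤1+n _) L≤u) ⟩
      u * u ^ e               ≤⟨ *-monoˡ-≤ (u ^ e) (m≤m*n u u {{>-nonZero 1≤u}}) ⟩
      u * u * u ^ e           ≡⟨ *-assoc u u (u ^ e) ⟩
      u ^ (2 + e)             ∎
      where open ≤-Reasoning
  ...   | no  L≰u = ≤-trans (*-mono-≤ kc≤L (^-monoˡ-≤ e (≰⇒> L≰u))) L^e≤m

binomials : (Δ : ℕ) → CVec Δ → ℕ
binomials Δ s = prodF (λ i → (Δ C toℕ i) ^ s i)

facts : ∀ {Δ} → CVec Δ → ℕ
facts s = prodF (λ i → s i !)

dist : ∀ {Δ} → CVec Δ → CVec Δ → ℕ
dist u v = sumF (λ i → ∣ u i - v i ∣)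

-- c ≤ Δ|S|: each vertex has at most Δ outside neighbours.
cut≤Δ*size : ∀ Δ (u : CVec Δ) → cut u ≤ Δ * sumF u
cut≤Δ*size Δ u = ≤-trans (sumF-mono _ (λ i → Δ * u i) (λ i → *-monoˡ-≤ (u i) (toℕ≤pred[n] i)))
                         (≤-reflexive (sumF-*ˡ Δ u))

weighted-distance : ∀ Δ (w : Fin (suc Δ) → ℕ) → (∀ i → w i ≤ Δ) → (u v : CVec Δ) →
                    ∣ sumF (λ i → w i * u i) - sumF (λ i → w i * v i) ∣ ≤ Δ * dist u v
weighted-distance Δ w w≤Δ u v = begin
  ∣ sumF (λ i → w i * u i) - sumF (λ i → w i * v i) ∣ ≤⟨ sumF-∣-∣ (λ i → w i * u i) (λ i → w i * v i) ⟩
  sumF (λ i → ∣ w i * u i - w i * v i ∣)            ≤⟨ sumF-mono _ _ termwise ⟩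
  sumF (λ i → Δ * ∣ u i - v i ∣)                    ≡⟨ sumF-*ˡ Δ (λ i → ∣ u i - v i ∣) ⟩
  Δ * dist u v                                      ∎
  where
  open ≤-Reasoning
  termwise : ∀ i → ∣ w i * u i - w i * v i ∣ ≤ Δ * ∣ u i - v i ∣
  termwise i = ≤-trans (≤-reflexive (sym (*-distribˡ-∣-∣ (w i) (u i) (v i)))) (*-monoˡ-≤ _ (w≤Δ i))

cut-distance : ∀ Δ (u v : CVec Δ) → ∣ cut u - cut v ∣ ≤ Δ * dist u v
cut-distance Δ = weighted-distance Δ toℕ toℕ≤pred[n]

∸-∸-gap : ∀ a b c d → (a ∸ b) ∸ (c ∸ d) ≤ (a ∸ c) + (d ∸ b)
∸-∸-gap a b c d = m≤n+o⇒m∸n≤o (a ∸ b) (c ∸ d) (subst (a ∸ b ≤_) (m+n∸n≡m _ b) (∸-monoˡ-≤ b a≤))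
  where
  open ≤-Reasoning
  a≤ : a ≤ (c ∸ d) + ((a ∸ c) + (d ∸ b)) + b
  a≤ = begin
    a                                     ≤⟨ m≤n+m∸n a c ⟩
    c + (a ∸ c)                           ≤⟨ +-monoˡ-≤ _ (m≤n+m∸n c d) ⟩
    d + (c ∸ d) + (a ∸ c)                 ≤⟨ +-monoˡ-≤ _ (+-monoˡ-≤ _ (m≤n+m∸n d b)) ⟩
    b + (d ∸ b) + (c ∸ d) + (a ∸ c)       ≡⟨ solve 4 (λ b x y z → b :+ x :+ y :+ z := y :+ (z :+ x) :+ b)
                                               refl b (d ∸ b) (c ∸ d) (a ∸ c) ⟩
    (c ∸ d) + ((a ∸ c) + (d ∸ b)) + b     ∎

-- The number Δ|S| - c of edges from S staying inside S changes by at most 2Δ·dist.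
free-gap : ∀ Δ (u v : CVec Δ) →
           (Δ * sumF u ∸ cut u) ∸ (Δ * sumF v ∸ cut v) ≤ Δ * dist u v + Δ * dist u v
free-gap Δ u v = ≤-trans (∸-∸-gap (Δ * sumF u) (cut u) (Δ * sumF v) (cut v)) (+-mono-≤ size-gap cut-gap)
  where
  size-gap : Δ * sumF u ∸ Δ * sumF v ≤ Δ * dist u v
  size-gap = ≤-trans (m∸n≤∣m-n∣ (Δ * sumF u) (Δ * sumF v))
    (≤-trans (≤-reflexive (sym (*-distribˡ-∣-∣ Δ (sumF u) (sumF v)))) (*-monoʳ-≤ Δ (sumF-∣-∣ u v)))
  cut-gap : cut v ∸ cut u ≤ Δ * dist u v
  cut-gap = ≤-trans (m∸n≤∣m-n∣ (cut v) (cut u)) (≤-trans (≤-reflexive (∣-∣-comm (cut v) (cut u))) (cut-distance Δ u v))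

binomials-dominated : ∀ Δ {M} → 2 ≤ M → (u v : CVec Δ) →
                      Dominated M (Δ * dist u v) (binomials Δ u) (binomials Δ v)
binomials-dominated Δ {M} 2≤M u v =
  dominated-weaken {{>-nonZero (≤-trans (s≤s z≤n) 2≤M)}} exponent
    (prodF-dominated _ _ (λ i → Δ * (u i ∸ v i)) termwise)
  where
  termwise : ∀ i → Dominated M (Δ * (u i ∸ v i)) ((Δ C toℕ i) ^ u i) ((Δ C toℕ i) ^ v i)
  termwise i = dominated-power {M} {Δ}
    (power-dominated (u i) (v i) (C-positive Δ (toℕ i) (toℕ≤pred[n] i))
                     (≤-trans (C≤2^ Δ (toℕ i)) (^-monoˡ-≤ Δ 2≤M)))
  exponent : sumF (λ i → Δ * (u i ∸ v i)) ≤ Δ * dist u v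
  exponent = ≤-trans (≤-reflexive (sumF-*ˡ Δ (λ i → u i ∸ v i)))
                     (*-monoʳ-≤ Δ (sumF-mono _ _ (λ i → m∸n≤∣m-n∣ (u i) (v i))))

facts-dominated : ∀ {Δ M} .{{_ : NonZero M}} (u v : CVec Δ) → (∀ i → v i ≤ M) →
                  Dominated M (dist u v) (facts v) (facts u)
facts-dominated u v v≤M = dominated-weaken exponent
  (prodF-dominated _ _ (λ i → v i ∸ u i) (λ i → factorialLike-dominated factorial-fl (v i) (u i) (v≤M i)))
  where
  exponent : sumF (λ i → v i ∸ u i) ≤ dist u v
  exponent = sumF-mono _ _ (λ i → subst (v i ∸ u i ≤_) (∣-∣-comm (v i) (u i)) (m∸n≤∣m-n∣ (v i) (u i)))

toℚᵘ-/ : ∀ a b → toℚᵘ (+ a / suc b) ≃ᵘ mkℚᵘ (+ a) b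
toℚᵘ-/ a b = toℚᵘ-fromℚᵘ (mkℚᵘ (+ a) b)

/-*-/ : ∀ a b c d .{{_ : NonZero b}} .{{_ : NonZero d}} →
        (+ a / b) *ℚ (+ c / d) ≡ (+ (a * c) / (b * d)) {{m*n≢0 b d}}
/-*-/ a (suc b) c (suc d) = toℚᵘ-injective
  (≃-trans (toℚᵘ-homo-* (+ a / suc b) (+ c / suc d))
  (≃-trans (*-cong (toℚᵘ-/ a b) (toℚᵘ-/ c d))
  (≃-trans (≃-reflexive (cong (λ z → mkℚᵘ z _) (sym (pos-* a c))))
           (≃-sym (toℚᵘ-/ (a * c) _)))))

/-*-integer : ∀ a b c .{{_ : NonZero b}} → (+ a / b) *ℚ (+ c / 1) ≡ + (a * c) / b
/-*-integer a b c = trans (/-*-/ a b c 1) (/-cong {+ (a * c)} {b * 1} {{m*n≢0 b 1}} refl (*-identityʳ b))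

/-≤-/ : ∀ a b c d .{{_ : NonZero b}} .{{_ : NonZero d}} → a * d ≤ c * b → + a / b ≤ℚ + c / d
/-≤-/ a (suc b) c (suc d) ad≤cb = toℚᵘ-cancel-≤
  (≤-respˡ-≃ (≃-sym (toℚᵘ-/ a b)) (≤-respʳ-≃ (≃-sym (toℚᵘ-/ c d))
    (*≤* (subst₂ ℤ._≤_ (pos-* a (suc d)) (pos-* c (suc b)) (ℤ.+≤+ ad≤cb)))))

numerator : (Δ : ℕ) → CVec Δ → CVec Δ → ℕ
numerator Δ s s' = sumF s ! * binomials Δ s * sumF s' ! * binomials Δ s' *
                   (cut s ! * (Δ * sumF s ∸ cut s) !! * (Δ * sumF s' ∸ cut s) !!)

denominator : (Δ : ℕ) → CVec Δ → CVec Δ → ℕ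
denominator Δ s s' = facts s * facts s' * (Δ * (sumF s + sumF s')) !!

denominator-nonZero : ∀ Δ s s' → NonZero (denominator Δ s s')
denominator-nonZero Δ s s' = m*n≢0 _ _ {{facts-nonZero}} {{dfact-nz (Δ * (sumF s + sumF s'))}}
  where
  facts-nonZero : NonZero (facts s * facts s')
  facts-nonZero = m*n≢0 _ _ {{prodFact-nz s}} {{prodFact-nz s'}}

P-fraction : ∀ Δ s s' → P Δ s s' ≡ (+ numerator Δ s s' / denominator Δ s s') {{denominator-nonZero Δ s s'}}
P-fraction Δ s s' = begin
  multinom s *ℚ binomProd Δ s *ℚ multinom s' *ℚ binomProd Δ s' *ℚ L
    ≡⟨ cong (λ q → q *ℚ multinom s' *ℚ binomProd Δ s' *ℚ L) (/-*-integer (S !) F (B s)) ⟩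
  + (S ! * B s) / F *ℚ multinom s' *ℚ binomProd Δ s' *ℚ L
    ≡⟨ cong (λ q → q *ℚ binomProd Δ s' *ℚ L) (/-*-/ (S ! * B s) F (S' !) F') ⟩
  + (S ! * B s * S' !) / (F * F') *ℚ binomProd Δ s' *ℚ L
    ≡⟨ cong (_*ℚ L) (/-*-integer (S ! * B s * S' !) (F * F') (B s')) ⟩
  + (S ! * B s * S' ! * B s') / (F * F') *ℚ L
    ≡⟨ /-*-/ (S ! * B s * S' ! * B s') (F * F') ℓ D ⟩
  + numerator Δ s s' / denominator Δ s s' ∎
  where
  open ≡-Reasoning
  S S' F F' D ℓ : ℕ
  S  = sumF s
  S' = sumF s'
  F  = facts s
  F' = facts s'
  D  = (Δ * (S + S')) !!
  ℓ  = cut s ! * (Δ * S ∸ cut s) !! * (Δ * S' ∸ cut s) !!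
  B : CVec Δ → ℕ
  B = binomials Δ
  instance
    F-nonZero : NonZero F
    F-nonZero = prodFact-nz s
    F'-nonZero : NonZero F'
    F'-nonZero = prodFact-nz s'
    FF'-nonZero : NonZero (F * F')
    FF'-nonZero = m*n≢0 F F'
    D-nonZero : NonZero D
    D-nonZero = dfact-nz (Δ * (S + S'))
    denominator-instance : NonZero (denominator Δ s s')
    denominator-instance = denominator-nonZero Δ s s'
  L : ℚ
  L = + ℓ / D

P-≤-scaled : ∀ Δ (s s' p p' : CVec Δ) F →
             numerator Δ s s' * denominator Δ p p' ≤ 2 ^ F * (numerator Δ p p' * denominator Δ s s') →
             P Δ s s' ≤ℚ (+ (2 ^ F) / 1) *ℚ P Δ p p'
P-≤-scaled Δ s s' p p' F cross =
  subst₂ _≤ℚ_ (sym (P-fraction Δ s s')) (sym scaled-P) (/-≤-/ Ns Ds (2 ^ F * Np) (1 * Dp) cross′)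
  where
  Ns Ds Np Dp : ℕ
  Ns = numerator Δ s s'
  Ds = denominator Δ s s'
  Np = numerator Δ p p'
  Dp = denominator Δ p p'
  instance
    Ds-nonZero : NonZero Ds
    Ds-nonZero = denominator-nonZero Δ s s'
    Dp-nonZero : NonZero Dp
    Dp-nonZero = denominator-nonZero Δ p p'
    1*Dp-nonZero : NonZero (1 * Dp)
    1*Dp-nonZero = m*n≢0 1 Dp

  scaled-P : (+ (2 ^ F) / 1) *ℚ P Δ p p' ≡ + (2 ^ F * Np) / (1 * Dp)
  scaled-P = trans (cong ((+ (2 ^ F) / 1) *ℚ_) (P-fraction Δ p p')) (/-*-/ (2 ^ F) 1 Np Dp)

  cross′ : Ns * (1 * Dp) ≤ 2 ^ F * Np * Ds
  cross′ = begin
    Ns * (1 * Dp)      ≡⟨ cong (Ns *_) (*-identityˡ Dp) ⟩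
    Ns * Dp            ≤⟨ cross ⟩
    2 ^ F * (Np * Ds)  ≡⟨ *-assoc (2 ^ F) Np Ds ⟨
    2 ^ F * Np * Ds    ∎
    where open ≤-Reasoning

module Perturbation (Δ n : ℕ) (1≤Δ : 1 ≤ Δ) (Δ^20<n : Δ ^ 20 < n) where

  t T M K : ℕ
  t = ceilRoot 20 n
  T = t ^ 16
  M = Δ * n
  K = Δ * T + Δ * T

  n≤t^20 : n ≤ t ^ 20
  n≤t^20 = above (ceilRoot-correct 20 n)

  Δ<t : Δ < t
  Δ<t = ^-reflectˡ-< 20 (≤-trans Δ^20<n n≤t^20)

  n≤M : n ≤ M
  n≤M = m≤n*m n Δ {{>-nonZero 1≤Δ}}

  2≤M : 2 ≤ M
  2≤M = ≤-trans (s≤s (m^n>0 Δ {{>-nonZero 1≤Δ}} 20)) (≤-trans Δ^20<n n≤M)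

  instance
    M-nonZero : NonZero M
    M-nonZero = >-nonZero (≤-trans (s≤s z≤n) 2≤M)

  -- |d| ≤ n^(3/4) ≤ t^15, so vectors within n^(3/4) in every coordinate are
  -- within (Δ+1)t^15 ≤ t^16 in ℓ¹.
  close : (u v : CVec Δ) → (∀ i → ∣ u i - v i ∣ ^ 4 ≤ n ^ 3) → dist u v ≤ T
  close u v near = ≤-trans (sumF-bounded _ (t ^ 15) coordinate) (*-monoˡ-≤ (t ^ 15) Δ<t)
    where
    n^3≤t^60 : n ^ 3 ≤ (t ^ 15) ^ 4
    n^3≤t^60 = ≤-trans (^-monoˡ-≤ 3 n≤t^20) (≤-reflexive (trans (^-*-assoc t 20 3) (sym (^-*-assoc t 15 4))))
    coordinate : ∀ i → ∣ u i - v i ∣ ≤ t ^ 15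
    coordinate i = ^-reflectˡ-≤ 4 (≤-trans (near i) n^3≤t^60)

  module Side (u v : CVec Δ) (u≤n : sumF u ≤ n) (v≤n : sumF v ≤ n) (uv-close : dist u v ≤ T) where

    ΔD≤ΔT : Δ * dist u v ≤ Δ * T
    ΔD≤ΔT = *-monoʳ-≤ Δ uv-close

    ΔT≤K : Δ * T ≤ K
    ΔT≤K = m≤m+n (Δ * T) (Δ * T)

    D≤K : dist u v ≤ K
    D≤K = ≤-trans uv-close (≤-trans (m≤n*m T Δ {{>-nonZero 1≤Δ}}) ΔT≤K)

    Δu≤M : Δ * sumF u ≤ M
    Δu≤M = *-monoʳ-≤ Δ u≤n

    within : ∀ {g} → FactorialLike g → ∀ a b → a ≤ M → a ∸ b ≤ K → Dominated M K (g a) (g b)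
    within g-fl a b a≤M gap = dominated-weaken gap (factorialLike-dominated g-fl a b a≤M)

    size! : Dominated M K (sumF u !) (sumF v !)
    size! = within factorial-fl (sumF u) (sumF v) (≤-trans u≤n n≤M)
      (≤-trans (m∸n≤∣m-n∣ (sumF u) (sumF v)) (≤-trans (sumF-∣-∣ u v) D≤K))

    cut! : Dominated M K (cut u !) (cut v !)
    cut! = within factorial-fl (cut u) (cut v) (≤-trans (cut≤Δ*size Δ u) Δu≤M)
      (≤-trans (m∸n≤∣m-n∣ (cut u) (cut v)) (≤-trans (cut-distance Δ u v) (≤-trans ΔD≤ΔT ΔT≤K)))

    free!! : Dominated M K ((Δ * sumF u ∸ cut u) !!) ((Δ * sumF v ∸ cut v) !!)
    free!! = within doubleFactorial-fl (Δ * sumF u ∸ cut u) (Δ * sumF v ∸ cut v)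
      (≤-trans (m∸n≤m (Δ * sumF u) (cut u)) Δu≤M)
      (≤-trans (free-gap Δ u v) (+-mono-≤ ΔD≤ΔT ΔD≤ΔT))

    binoms : Dominated M K (binomials Δ u) (binomials Δ v)
    binoms = dominated-weaken (≤-trans ΔD≤ΔT ΔT≤K) (binomials-dominated Δ 2≤M u v)

    factsᵛ : Dominated M K (facts v) (facts u)
    factsᵛ = dominated-weaken D≤K
      (facts-dominated u v (λ i → ≤-trans (term≤sumF v i) (≤-trans v≤n n≤M)))

  -- M^(9K) ≤ 2^(378 t^18), using M ≤ t^21 ≤ 2^(21t) and K ≤ 2t^17.
  M^9K≤ : M ^ (9 * K) ≤ 2 ^ (378 * t ^ 18)
  M^9K≤ = begin
    M ^ (9 * K)                             ≤⟨ ^-monoʳ-≤ M (*-monoʳ-≤ 9 (+-mono-≤ ΔT≤t^17 ΔT≤t^17)) ⟩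
    M ^ (9 * (t ^ 17 + t ^ 17))             ≤⟨ ^-monoˡ-≤ (9 * (t ^ 17 + t ^ 17)) M≤2^21t ⟩
    (2 ^ (t * 21)) ^ (9 * (t ^ 17 + t ^ 17)) ≡⟨ ^-*-assoc 2 (t * 21) _ ⟩
    2 ^ (t * 21 * (9 * (t ^ 17 + t ^ 17)))  ≡⟨ cong (2 ^_) (solve 2 (λ t x → t :* con 21 :* (con 9 :* (x :+ x))
                                                                  := con 378 :* (t :* x)) refl t (t ^ 17)) ⟩
    2 ^ (378 * t ^ 18)                      ∎
    where
    open ≤-Reasoning
    ΔT≤t^17 : Δ * T ≤ t ^ 17
    ΔT≤t^17 = *-monoˡ-≤ T (<⇒≤ Δ<t)
    M≤2^21t : M ≤ 2 ^ (t * 21)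
    M≤2^21t = begin
      Δ * n            ≤⟨ *-mono-≤ (<⇒≤ Δ<t) n≤t^20 ⟩
      t ^ 21           ≤⟨ ^-monoˡ-≤ 21 (n≤2^n t) ⟩
      (2 ^ t) ^ 21     ≡⟨ ^-*-assoc 2 t 21 ⟩
      2 ^ (t * 21)     ∎

  summands≤ : ∀ a b → a + b ≡ n → a ≤ n × b ≤ n
  summands≤ a b refl = m≤m+n a b , m≤n+m b a

  perturbation : ∀ (s s' p p' : CVec Δ) → IsConfigPair n Δ s s' → IsConfigPair n Δ p p' →
                 (∀ i → ∣ s i - p i ∣ ^ 4 ≤ n ^ 3) → (∀ i → ∣ s' i - p' i ∣ ^ 4 ≤ n ^ 3) →
                 P Δ s s' ≤ℚ (+ (2 ^ (378 * t ^ 18)) / 1) *ℚ P Δ p p'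
  perturbation s s' p p' (s-size , s-cut) (p-size , p-cut) near near' =
    P-≤-scaled Δ s s' p p' (378 * t ^ 18) cross
    where
    s≤n : sumF s ≤ n × sumF s' ≤ n
    s≤n = summands≤ (sumF s) (sumF s') s-size
    p≤n : sumF p ≤ n × sumF p' ≤ n
    p≤n = summands≤ (sumF p) (sumF p') p-size
    module S  = Side s  p  (proj₁ s≤n) (proj₁ p≤n) (close s p near)
    module S' = Side s' p' (proj₂ s≤n) (proj₂ p≤n) (close s' p' near')

    -- the last factor of P(s,s') uses c = cut s = cut s'
    free'!! : Dominated M K ((Δ * sumF s' ∸ cut s) !!) ((Δ * sumF p' ∸ cut p) !!)
    free'!! = subst₂ (λ a b → Dominated M K ((Δ * sumF s' ∸ a) !!) ((Δ * sumF p' ∸ b) !!))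
                     (sym s-cut) (sym p-cut) S'.free!!

    numerator≼ : Dominated M (K + K + K + K + (K + K + K)) (numerator Δ s s') (numerator Δ p p')
    numerator≼ = dominated-* (dominated-* (dominated-* (dominated-* S.size! S.binoms) S'.size!) S'.binoms)
                             (dominated-* (dominated-* S.cut! S.free!!) free'!!)

    -- both double factorials are (Δn)!!
    denominator≼ : Dominated M (K + K + 0) (denominator Δ p p') (denominator Δ s s')
    denominator≼ = dominated-* (dominated-* S.factsᵛ S'.factsᵛ)
                               (dominated-≡ (cong (λ m → (Δ * m) !!) (trans p-size (sym s-size))))

    nine-factors : K + K + K + K + (K + K + K) + (K + K + 0) ≤ 9 * K
    nine-factors = ≤-reflexive (solve 1 (λ k → k :+ k :+ k :+ k :+ (k :+ k :+ k) :+ (k :+ k :+ con 0)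
                                              := con 9 :* k) refl K)

    cross : numerator Δ s s' * denominator Δ p p' ≤ 2 ^ (378 * t ^ 18) * (numerator Δ p p' * denominator Δ s s')
    cross = ≤-trans (bound (dominated-weaken nine-factors (dominated-* numerator≼ denominator≼)))
                    (*-monoˡ-≤ (numerator Δ p p' * denominator Δ s s') M^9K≤)

lemma1 : Σ (ℕ → ℕ) λ f →
           (∀ k → ∃[ N ] ∀ m → N ≤ m → k * f m ≤ m)
           × (∀ (Δ n : ℕ) → 1 ≤ Δ → 2 ∣ n → Δ ^ 20 < n →
              ∀ (s s' p p' : CVec Δ) →
              IsConfigPair n Δ s s' → IsConfigPair n Δ p p' →
              (∀ i → ∣ s i - p i ∣ ^ 4 ≤ n ^ 3) →
              (∀ i → ∣ s' i - p' i ∣ ^ 4 ≤ n ^ 3) →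
              P Δ s s' ≤ℚ (+ (2 ^ f n) / 1) *ℚ P Δ p p')
lemma1 = (λ m → 378 * ceilRoot 20 m ^ 18)
       , ceilRoot-power-sublinear 378 18
       , λ Δ n 1≤Δ _ Δ^20<n → Perturbation.perturbation Δ n 1≤Δ Δ^20<n
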